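{- For every $n\ge1$ and every word $\sigma\in\{\bullet,\circ\}^n$, $Z_\sigma(1,1,1,1;1)=2^n n!$; that is, there are exactly $2^n n!$ staircase tableaux of each type $\sigma$ of length $n$.
   Context: A staircase tableau of size $n$ is a filling of the Young diagram of staircase shape $(n,n-1,\dots,1)$ (English convention: row $r$ consists of columns $1,\dots,n+1-r$; the diagonal boxes are the last boxes of the rows) in which each box is empty or labeled by one of $\alpha,\beta,\gamma,\delta$, such that: no diagonal box is empty; every box in the same row and to the left of a $\beta$ or a $\delta$ is empty; every box in the same column and above an $\alpha$ or a $\gamma$ is empty. The type of $T$ is the word in $\{\bullet,\circ\}^n$ obtained by reading the diagonal boxes from northeast to southwest, writing $\bullet$ for $\alpha$ or $\delta$ and $\circ$ for $\beta$ or $\gamma$. Each empty box is assigned $q$ or $1$ according to the nearest labeled box to its right in its row and the nearest labeled box below it in its column: it gets $1$ if it sees a $\beta$ to its right; $q$ if it sees a $\delta$ to its right; $1$ if it sees an $\alpha$ or $\gamma$ to its right and an $\alpha$ or $\delta$ below it; $q$ if it sees an $\alpha$ or $\gamma$ to its right and a $\beta$ or $\gamma$ below it. The weight $\mathrm{wt}(T)$ is the product of all labels $\alpha,\beta,\gamma,\delta$ in $T$ and all assigned $q$'s. For a word $\sigma$, $Z_\sigma(\alpha,\beta,\gamma,\delta;q)=\sum_T\mathrm{wt}(T)$, summed over staircase tableaux of type $\sigma$. -}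

module Defs where

open import Data.Nat using (ℕ; zero; suc; _+_; _*_; _∸_)
open import Data.Bool using (Bool; true; false; _∧_; _∨_; not; if_then_else_)
open import Data.Maybe using (Maybe; just; nothing)
open import Data.List using (List; []; _∷_; map; concatMap; upTo; applyUpTo)
open import Data.Bool.ListAction using (and)
open import Data.Nat.ListAction using (sum; product)
open import Data.Vec using (Vec; toList)
import Data.Vec as V
open import Data.Product using (_×_; _,_)
open import Data.Unit using (⊤; tt)

data Label : Set where
  α β γ δ : Label

Cell : Set
Cell = Maybe Label

data Particle : Set where
  ● ○ : Particle

-- Fillings of the staircase Young diagram (n, n-1, ..., 1):
-- the first (top) row has n boxes, then a staircase of size n-1 below it.
-- Rows and columns are 0-indexed below: box (r , c) exists iff r < n and c < n ∸ r;
-- the diagonal box of row r is (r , n ∸ suc r).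
Filling : ℕ → Set
Filling zero    = ⊤
Filling (suc k) = Vec Cell (suc k) × Filling k

rowsOf : (n : ℕ) → Filling n → List (List Cell)
rowsOf zero    tt       = []
rowsOf (suc k) (x , xs) = toList x ∷ rowsOf k xs

allCells : List Cell
allCells = nothing ∷ just α ∷ just β ∷ just γ ∷ just δ ∷ []

allVecs : (k : ℕ) → List (Vec Cell k)
allVecs zero    = V.[] ∷ []
allVecs (suc k) = concatMap (λ x → map (λ v → x V.∷ v) (allVecs k)) allCells

allFillings : (n : ℕ) → List (Filling n)
allFillings zero    = tt ∷ []
allFillings (suc k) = concatMap (λ v → map (λ f → v , f) (allFillings k)) (allVecs (suc k))

_!?_ : {A : Set} → List A → ℕ → Maybe A
[]       !? _     = nothing
(x ∷ xs) !? zero  = just x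
(x ∷ xs) !? suc i = xs !? i

-- content of box (r , c); nonexistent boxes read as empty (never used for them)
lab : List (List Cell) → ℕ → ℕ → Cell
lab rows r c with rows !? r
... | nothing = nothing
... | just row with row !? c
...   | nothing = nothing
...   | just x  = x

isEmpty : Cell → Bool
isEmpty nothing = true
isEmpty (just _) = false

isβδ : Cell → Bool
isβδ (just β) = true
isβδ (just δ) = true
isβδ _        = false

isαγ : Cell → Bool
isαγ (just α) = true
isαγ (just γ) = true
isαγ _        = false

allᵇ : {A : Set} → (A → Bool) → List A → Bool
allᵇ p xs = and (map p xs)

range : ℕ → ℕ → List ℕ
range a b = applyUpTo (λ i → a + i) (b ∸ a)

_⇒ᵇ_ : Bool → Bool → Bool
a ⇒ᵇ b = not a ∨ b

isStaircaseTableau : (n : ℕ) → Filling n → Bool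
isStaircaseTableau n f =
  allᵇ (λ r → allᵇ (λ c → boxOK r c) (upTo (n ∸ r))) (upTo n)
  where
  rows = rowsOf n f
  boxOK : ℕ → ℕ → Bool
  boxOK r c =
    ((c Data.Nat.≡ᵇ (n ∸ suc r)) ⇒ᵇ not (isEmpty (lab rows r c)))
    ∧ (isβδ (lab rows r c) ⇒ᵇ allᵇ (λ c' → isEmpty (lab rows r c')) (upTo c))
    ∧ (isαγ (lab rows r c) ⇒ᵇ allᵇ (λ r' → isEmpty (lab rows r' c)) (upTo r))

-- type of a filling: diagonal boxes read from northeast (row 0) to southwest (row n-1)
particleOf : Cell → Particle
particleOf (just α) = ●
particleOf (just δ) = ●
particleOf _        = ○

typeOf : (n : ℕ) → Filling n → List Particle
typeOf n f = map (λ r → particleOf (lab (rowsOf n f) r (n ∸ suc r))) (upTo n)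

eqP : Particle → Particle → Bool
eqP ● ● = true
eqP ○ ○ = true
eqP _ _ = false

eqWord : List Particle → List Particle → Bool
eqWord []       []       = true
eqWord (x ∷ xs) (y ∷ ys) = eqP x y ∧ eqWord xs ys
eqWord _        _        = false

firstLabel : List Cell → Cell
firstLabel []             = nothing
firstLabel (nothing ∷ xs) = firstLabel xs
firstLabel (just l ∷ xs)  = just l

weight : (n : ℕ) → (a b g d q : ℕ) → Filling n → ℕ
weight n a b g d q f =
  product (map (λ r → product (map (λ c → boxW r c) (upTo (n ∸ r)))) (upTo n))
  where
  rows = rowsOf n f
  labW : Label → ℕ
  labW α = a
  labW β = b
  labW γ = g
  labW δ = d
  right : ℕ → ℕ → Cell
  right r c = firstLabel (map (λ c' → lab rows r c') (range (suc c) (n ∸ r)))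
  below : ℕ → ℕ → Cell
  below r c = firstLabel (map (λ r' → lab rows r' c) (range (suc r) n))
  emptyW : Cell → Cell → ℕ
  emptyW (just β) _        = 1
  emptyW (just δ) _        = q
  emptyW (just α) (just α) = 1
  emptyW (just α) (just δ) = 1
  emptyW (just α) (just β) = q
  emptyW (just α) (just γ) = q
  emptyW (just γ) (just α) = 1
  emptyW (just γ) (just δ) = 1
  emptyW (just γ) (just β) = q
  emptyW (just γ) (just γ) = q
  emptyW _        _        = 1   -- unreachable for staircase tableaux
  boxW : ℕ → ℕ → ℕ
  boxW r c with lab rows r c
  ... | just l  = labW l
  ... | nothing = emptyW (right r c) (below r c)

Z : (n : ℕ) → Vec Particle n → (a b g d q : ℕ) → ℕ
Z n σ a b g d q =
  sum (map (λ f → if isStaircaseTableau n f ∧ eqWord (typeOf n f) (toList σ)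
                  then weight n a b g d q f else 0)
           (allFillings n))

-- Deleting the top row of a staircase tableau of size k + 1 leaves one of size k. The top
-- rows extending a given smaller tableau T are constrained only by the row rule, by the type
-- letter of their last box, and by being empty above the columns of T containing an α or γ.
-- Weighting each tableau by X ^ (number of columns free of α and γ), the sum over these top
-- rows is (1 + X) (2 + X) ^ f when T has f free columns, so Z_X (s σ) = (1 + X) Z_(X+2) σ.
-- Hence the number of tableaux of type σ is Z_1 = 2 · 4 ⋯ 2n = 2 ^ n n!.
module Submission where

open import Defs
open import Data.Bool using (Bool; true; false; _∧_; _∨_; not; if_then_else_)
open import Data.Bool.Properties using (∧-commutativeMonoid; ∧-assoc; ∧-zeroʳ; ∧-identityʳ)
open import Data.Bool.Solver using (module ∨-∧-Solver)
open import Data.List using (List; []; _∷_; _++_; map; upTo; applyUpTo; concatMap)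
open import Data.List.Properties using (map-++; map-cong; map-∘; map-applyUpTo)
open import Data.Maybe using (maybe′; fromMaybe; just; nothing)
open import Data.Nat using (ℕ; zero; suc; _+_; _*_; _∸_; _^_; _≡ᵇ_; _!; _≤_)
open import Data.Nat.ListAction using (sum; product)
open import Data.Nat.ListAction.Properties using (sum-++)
open import Data.Nat.Properties
  using (+-commutativeSemigroup; +-comm; +-identityʳ; +-suc; *-assoc; *-zeroʳ; *-identityˡ; *-identityʳ;
         *-distribˡ-+; ^-zeroˡ; ^-distribˡ-+-*)
open import Data.Nat.Tactic.RingSolver using (solve-∀)
open import Data.Product using (_,_)
open import Data.Unit using (tt)
open import Data.Vec using (Vec; toList) renaming ([] to []ᵛ; _∷_ to _∷ᵛ_)
open import Function using (_∘_)
open import Relation.Binary.PropositionalEquality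
  using (_≡_; refl; sym; trans; cong; cong₂; _≗_; module ≡-Reasoning)
open import Algebra.Bundles using (CommutativeMonoid)
open import Algebra.Properties.CommutativeSemigroup
  (CommutativeMonoid.commutativeSemigroup ∧-commutativeMonoid)
  using () renaming (interchange to ∧-interchange)
open import Algebra.Properties.CommutativeSemigroup +-commutativeSemigroup
  using () renaming (interchange to +-interchange)

private
  variable
    A B : Set
    k : ℕ

allBelow : ℕ → (ℕ → Bool) → Bool
allBelow zero    p = true
allBelow (suc n) p = p 0 ∧ allBelow n (p ∘ suc)

allᵇ-applyUpTo : ∀ (p : ℕ → Bool) (g : ℕ → ℕ) n → allᵇ p (applyUpTo g n) ≡ allBelow n (p ∘ g)
allᵇ-applyUpTo p g zero    = refl
allᵇ-applyUpTo p g (suc n) = cong (p (g 0) ∧_) (allᵇ-applyUpTo p (g ∘ suc) n)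

allᵇ-upTo : ∀ (p : ℕ → Bool) n → allᵇ p (upTo n) ≡ allBelow n p
allᵇ-upTo p = allᵇ-applyUpTo p (λ i → i)

allBelow-cong : ∀ n {p q : ℕ → Bool} → p ≗ q → allBelow n p ≡ allBelow n q
allBelow-cong zero    p≗q = refl
allBelow-cong (suc n) p≗q = cong₂ _∧_ (p≗q 0) (allBelow-cong n (p≗q ∘ suc))

allBelow-∧ : ∀ n (p q : ℕ → Bool) → allBelow n (λ i → p i ∧ q i) ≡ allBelow n p ∧ allBelow n q
allBelow-∧ zero    p q = refl
allBelow-∧ (suc n) p q =
  trans (cong ((p 0 ∧ q 0) ∧_) (allBelow-∧ n (p ∘ suc) (q ∘ suc))) (∧-interchange (p 0) (q 0) _ _)

-- `lab` is defined by `with`, so `lab (row ∷ rows) 0 c` does not reduce to a lookup in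
-- `row`; `boxAt` does.
cellAt : List Cell → ℕ → Cell
cellAt row c = fromMaybe nothing (row !? c)

boxAt : List (List Cell) → ℕ → ℕ → Cell
boxAt rows r c = maybe′ (λ row → cellAt row c) nothing (rows !? r)

lab≡boxAt : ∀ rows r c → lab rows r c ≡ boxAt rows r c
lab≡boxAt rows r c with rows !? r
... | nothing = refl
... | just row with row !? c
...   | nothing = refl
...   | just x  = refl

boxOK : ℕ → List (List Cell) → ℕ → ℕ → Bool
boxOK n rows r c =
    ((c ≡ᵇ n ∸ suc r) ⇒ᵇ not (isEmpty (boxAt rows r c)))
  ∧ (isβδ (boxAt rows r c) ⇒ᵇ allBelow c (λ c′ → isEmpty (boxAt rows r c′)))
  ∧ (isαγ (boxAt rows r c) ⇒ᵇ allBelow r (λ r′ → isEmpty (boxAt rows r′ c)))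

isTableau : ℕ → List (List Cell) → Bool
isTableau n rows = allBelow n (λ r → allBelow (n ∸ r) (boxOK n rows r))

isStaircaseTableau≡isTableau : ∀ n f → isStaircaseTableau n f ≡ isTableau n (rowsOf n f)
isStaircaseTableau≡isTableau n f =
  trans (allᵇ-upTo _ n) (allBelow-cong n λ r →
    trans (allᵇ-upTo _ (n ∸ r)) (allBelow-cong (n ∸ r) (boxOK≡ r)))
  where
  rows = rowsOf n f
  boxOK≡ : ∀ r c →
    ((c ≡ᵇ n ∸ suc r) ⇒ᵇ not (isEmpty (lab rows r c)))
    ∧ (isβδ (lab rows r c) ⇒ᵇ allᵇ (λ c′ → isEmpty (lab rows r c′)) (upTo c))
    ∧ (isαγ (lab rows r c) ⇒ᵇ allᵇ (λ r′ → isEmpty (lab rows r′ c)) (upTo r))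
    ≡ boxOK n rows r c
  boxOK≡ r c
    rewrite allᵇ-upTo (λ c′ → isEmpty (lab rows r c′)) c
          | allᵇ-upTo (λ r′ → isEmpty (lab rows r′ c)) r
          | allBelow-cong c (λ c′ → cong isEmpty (lab≡boxAt rows r c′))
          | allBelow-cong r (λ r′ → cong isEmpty (lab≡boxAt rows r′ c))
          | lab≡boxAt rows r c = refl

typeWord : ℕ → List (List Cell) → List Particle
typeWord n rows = applyUpTo (λ r → particleOf (boxAt rows r (n ∸ suc r))) n

typeOf≡typeWord : ∀ n f → typeOf n f ≡ typeWord n (rowsOf n f)
typeOf≡typeWord n f =
  trans (map-cong (λ r → cong particleOf (lab≡boxAt (rowsOf n f) r (n ∸ suc r))) (upTo n))
        (map-applyUpTo (λ i → i) _ n)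

-- For e = true this is boxOK for row 0, whose column condition is vacuous. In the induction
-- along the row, e says that all boxes to the left are empty.
topBoxOK : Bool → ℕ → List Cell → ℕ → Bool
topBoxOK e k row c =
    ((c ≡ᵇ k) ⇒ᵇ not (isEmpty (cellAt row c)))
  ∧ (isβδ (cellAt row c) ⇒ᵇ (e ∧ allBelow c (isEmpty ∘ cellAt row)))
  ∧ (isαγ (cellAt row c) ⇒ᵇ true)

topRowOK : Bool → ℕ → List Cell → Bool
topRowOK e k row = allBelow (suc k) (topBoxOK e k row)

αγColumnsSatisfy : ℕ → List (List Cell) → (ℕ → Bool) → Bool
αγColumnsSatisfy k rows e = allBelow k λ r → allBelow (k ∸ r) λ c → isαγ (boxAt rows r c) ⇒ᵇ e c

⇒ᵇ-∧-split : ∀ a b p e q → a ∧ b ∧ (p ⇒ᵇ (e ∧ q)) ≡ (a ∧ b ∧ (p ⇒ᵇ q)) ∧ (p ⇒ᵇ e)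
⇒ᵇ-∧-split false b     p     e     q = refl
⇒ᵇ-∧-split true  false p     e     q = refl
⇒ᵇ-∧-split true  true  false e     q = refl
⇒ᵇ-∧-split true  true  true  false q = sym (∧-zeroʳ q)
⇒ᵇ-∧-split true  true  true  true  q = sym (∧-identityʳ q)

boxOK-∷ : ∀ k row rows r c → boxOK (suc k) (row ∷ rows) (suc r) c ≡
  boxOK k rows r c ∧ (isαγ (boxAt rows r c) ⇒ᵇ isEmpty (cellAt row c))
boxOK-∷ k row rows r c = ⇒ᵇ-∧-split
  ((c ≡ᵇ k ∸ suc r) ⇒ᵇ not (isEmpty x))
  (isβδ x ⇒ᵇ allBelow c (λ c′ → isEmpty (boxAt rows r c′)))
  (isαγ x) (isEmpty (cellAt row c)) (allBelow r (λ r′ → isEmpty (boxAt rows r′ c)))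
  where x = boxAt rows r c

isTableau-∷ : ∀ k row rows → isTableau (suc k) (row ∷ rows) ≡
  topRowOK true k row ∧ (isTableau k rows ∧ αγColumnsSatisfy k rows (isEmpty ∘ cellAt row))
isTableau-∷ k row rows = cong (topRowOK true k row ∧_) (begin
  allBelow k (λ r → allBelow (k ∸ r) (boxOK (suc k) (row ∷ rows) (suc r)))
    ≡⟨ allBelow-cong k (λ r → allBelow-cong (k ∸ r) (boxOK-∷ k row rows r)) ⟩
  allBelow k (λ r → allBelow (k ∸ r) λ c → boxOK k rows r c ∧ (isαγ (boxAt rows r c) ⇒ᵇ e c))
    ≡⟨ allBelow-cong k (λ r → allBelow-∧ (k ∸ r) _ _) ⟩
  allBelow k (λ r → allBelow (k ∸ r) (boxOK k rows r) ∧ allBelow (k ∸ r) λ c → isαγ (boxAt rows r c) ⇒ᵇ e c)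
    ≡⟨ allBelow-∧ k _ _ ⟩
  isTableau k rows ∧ αγColumnsSatisfy k rows e ∎)
  where
  open ≡-Reasoning
  e = isEmpty ∘ cellAt row

rowOK : Bool → Vec Cell (suc k) → Bool
rowOK e (x ∷ᵛ []ᵛ)     = not (isEmpty x) ∧ (isβδ x ⇒ᵇ e)
rowOK e (x ∷ᵛ y ∷ᵛ v) = (isβδ x ⇒ᵇ e) ∧ rowOK (e ∧ isEmpty x) (y ∷ᵛ v)

topBoxOK-sole : ∀ e x → topBoxOK e 0 (x ∷ []) 0 ∧ true ≡ rowOK e (x ∷ᵛ []ᵛ)
topBoxOK-sole e     nothing  = refl
topBoxOK-sole e     (just α) = refl
topBoxOK-sole false (just β) = refl
topBoxOK-sole true  (just β) = refl
topBoxOK-sole e     (just γ) = refl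
topBoxOK-sole false (just δ) = refl
topBoxOK-sole true  (just δ) = refl

topBoxOK-head : ∀ e k x row t → topBoxOK e (suc k) (x ∷ row) 0 ∧ t ≡ (isβδ x ⇒ᵇ e) ∧ t
topBoxOK-head e     k nothing  row t = refl
topBoxOK-head e     k (just α) row t = refl
topBoxOK-head false k (just β) row t = refl
topBoxOK-head true  k (just β) row t = refl
topBoxOK-head e     k (just γ) row t = refl
topBoxOK-head false k (just δ) row t = refl
topBoxOK-head true  k (just δ) row t = refl

topBoxOK-∷ : ∀ e k x row c → topBoxOK e (suc k) (x ∷ row) (suc c) ≡ topBoxOK (e ∧ isEmpty x) k row c
topBoxOK-∷ e k x row c =
  cong (λ t → ((c ≡ᵇ k) ⇒ᵇ not (isEmpty y)) ∧ (isβδ y ⇒ᵇ t) ∧ (isαγ y ⇒ᵇ true))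
       (sym (∧-assoc e (isEmpty x) (allBelow c (isEmpty ∘ cellAt row))))
  where y = cellAt row c

topRowOK≡rowOK : ∀ e k (v : Vec Cell (suc k)) → topRowOK e k (toList v) ≡ rowOK e v
topRowOK≡rowOK e zero    (x ∷ᵛ []ᵛ)     = topBoxOK-sole e x
topRowOK≡rowOK e (suc k) (x ∷ᵛ y ∷ᵛ v) =
  trans (cong (topBoxOK e (suc k) (x ∷ row) 0 ∧_)
              (trans (allBelow-cong (suc k) (topBoxOK-∷ e k x row))
                     (topRowOK≡rowOK (e ∧ isEmpty x) k (y ∷ᵛ v))))
        (topBoxOK-head e k x row _)
  where row = toList (y ∷ᵛ v)

markαγ : Vec Cell (suc k) → Vec Bool k → Vec Bool (suc k)
markαγ (x ∷ᵛ []ᵛ)     []ᵛ       = isαγ x ∷ᵛ []ᵛ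
markαγ (x ∷ᵛ y ∷ᵛ v) (b ∷ᵛ m) = (isαγ x ∨ b) ∷ᵛ markαγ (y ∷ᵛ v) m

blockedColumns : (k : ℕ) → Filling k → Vec Bool k
blockedColumns zero    tt      = []ᵛ
blockedColumns (suc k) (v , f) = markαγ v (blockedColumns k f)

holdsOnBlocked : Vec Bool k → (ℕ → Bool) → Bool
holdsOnBlocked []ᵛ       e = true
holdsOnBlocked (b ∷ᵛ m) e = (b ⇒ᵇ e 0) ∧ holdsOnBlocked m (e ∘ suc)

⇒ᵇ-∨-merge : ∀ a b e s t → ((a ⇒ᵇ e) ∧ s) ∧ ((b ⇒ᵇ e) ∧ t) ≡ ((a ∨ b) ⇒ᵇ e) ∧ (s ∧ t)
⇒ᵇ-∨-merge false false e     s t = refl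
⇒ᵇ-∨-merge false true  false s t = ∧-zeroʳ s
⇒ᵇ-∨-merge false true  true  s t = refl
⇒ᵇ-∨-merge true  b     false s t = refl
⇒ᵇ-∨-merge true  false true  s t = refl
⇒ᵇ-∨-merge true  true  true  s t = refl

holdsOnBlocked-markαγ : ∀ (v : Vec Cell (suc k)) m e →
  allBelow (suc k) (λ c → isαγ (cellAt (toList v) c) ⇒ᵇ e c) ∧ holdsOnBlocked m e ≡
  holdsOnBlocked (markαγ v m) e
holdsOnBlocked-markαγ (x ∷ᵛ []ᵛ)     []ᵛ       e = ∧-identityʳ ((isαγ x ⇒ᵇ e 0) ∧ true)
holdsOnBlocked-markαγ (x ∷ᵛ y ∷ᵛ v) (b ∷ᵛ m) e =
  trans (⇒ᵇ-∨-merge (isαγ x) b (e 0) _ _)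
        (cong (((isαγ x ∨ b) ⇒ᵇ e 0) ∧_) (holdsOnBlocked-markαγ (y ∷ᵛ v) m (e ∘ suc)))

αγColumnsSatisfy≡holdsOnBlocked : ∀ k f e →
  αγColumnsSatisfy k (rowsOf k f) e ≡ holdsOnBlocked (blockedColumns k f) e
αγColumnsSatisfy≡holdsOnBlocked zero    tt      e = refl
αγColumnsSatisfy≡holdsOnBlocked (suc k) (v , f) e =
  trans (cong (allBelow (suc k) (λ c → isαγ (cellAt (toList v) c) ⇒ᵇ e c) ∧_)
              (αγColumnsSatisfy≡holdsOnBlocked k f e))
        (holdsOnBlocked-markαγ v (blockedColumns k f) e)

hasType : (k : ℕ) → Vec Particle k → Filling k → Bool
hasType k σ f = isStaircaseTableau k f ∧ eqWord (typeOf k f) (toList σ)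

∧-regroup : ∀ t s h p w → (t ∧ (s ∧ h)) ∧ (p ∧ w) ≡ (s ∧ w) ∧ (t ∧ (h ∧ p))
∧-regroup = solve 5 (λ t s h p w → (t :* (s :* h)) :* (p :* w) := (s :* w) :* (t :* (h :* p))) refl
  where open ∨-∧-Solver

hasType-∷ : ∀ k s σ (v : Vec Cell (suc k)) f → hasType (suc k) (s ∷ᵛ σ) (v , f) ≡
  hasType k σ f ∧ (rowOK true v ∧ (holdsOnBlocked (blockedColumns k f) (isEmpty ∘ cellAt (toList v))
                                   ∧ eqP (particleOf (cellAt (toList v) k)) s))
hasType-∷ k s σ v f = begin
  isStaircaseTableau (suc k) (v , f) ∧ eqWord (typeOf (suc k) (v , f)) (s ∷ toList σ)
    ≡⟨ cong₂ _∧_ (isStaircaseTableau≡isTableau (suc k) (v , f))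
                 (cong (λ w → eqWord w (s ∷ toList σ)) (typeOf≡typeWord (suc k) (v , f))) ⟩
  isTableau (suc k) (row ∷ rows) ∧ (lastOK ∧ eqWord (typeWord k rows) (toList σ))
    ≡⟨ cong₂ _∧_ (isTableau-∷ k row rows)
                 (cong (λ w → lastOK ∧ eqWord w (toList σ)) (sym (typeOf≡typeWord k f))) ⟩
  (topRowOK true k row ∧ (isTableau k rows ∧ αγColumnsSatisfy k rows (isEmpty ∘ cellAt row))) ∧ (lastOK ∧ typeOK)
    ≡⟨ cong (_∧ (lastOK ∧ typeOK))
            (cong₂ _∧_ (topRowOK≡rowOK true k v)
                       (cong₂ _∧_ (sym (isStaircaseTableau≡isTableau k f)) (αγColumnsSatisfy≡holdsOnBlocked k f _))) ⟩
  (rowOK true v ∧ (isStaircaseTableau k f ∧ clearOK)) ∧ (lastOK ∧ typeOK)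
    ≡⟨ ∧-regroup (rowOK true v) (isStaircaseTableau k f) clearOK lastOK typeOK ⟩
  hasType k σ f ∧ (rowOK true v ∧ (clearOK ∧ lastOK)) ∎
  where
  open ≡-Reasoning
  row = toList v
  rows = rowsOf k f
  clearOK = holdsOnBlocked (blockedColumns k f) (isEmpty ∘ cellAt row)
  lastOK = eqP (particleOf (cellAt row k)) s
  typeOK = eqWord (typeOf k f) (toList σ)

sum-map-++ : ∀ (g : A → ℕ) xs ys → sum (map g (xs ++ ys)) ≡ sum (map g xs) + sum (map g ys)
sum-map-++ g xs ys = trans (cong sum (map-++ g xs ys)) (sum-++ (map g xs) (map g ys))

sum-map-concatMap : ∀ (h : A → List B) (g : B → ℕ) xs →
  sum (map g (concatMap h xs)) ≡ sum (map (λ a → sum (map g (h a))) xs)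
sum-map-concatMap h g []       = refl
sum-map-concatMap h g (x ∷ xs) =
  trans (sum-map-++ g (h x) (concatMap h xs)) (cong (sum (map g (h x)) +_) (sum-map-concatMap h g xs))

sum-map-zero : ∀ (xs : List A) → sum (map (λ _ → 0) xs) ≡ 0
sum-map-zero []       = refl
sum-map-zero (x ∷ xs) = sum-map-zero xs

sum-map-*ˡ : ∀ c (g : A → ℕ) xs → sum (map (λ a → c * g a) xs) ≡ c * sum (map g xs)
sum-map-*ˡ c g []       = sym (*-zeroʳ c)
sum-map-*ˡ c g (x ∷ xs) = trans (cong (c * g x +_) (sum-map-*ˡ c g xs)) (sym (*-distribˡ-+ c (g x) _))

sum-map-if : ∀ b (g : A → ℕ) xs → sum (map (λ a → if b then g a else 0) xs) ≡ (if b then sum (map g xs) else 0)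
sum-map-if true  g xs = refl
sum-map-if false g xs = sum-map-zero xs

sum-map-+ : ∀ (g h : A → ℕ) xs → sum (map (λ a → g a + h a) xs) ≡ sum (map g xs) + sum (map h xs)
sum-map-+ g h []       = refl
sum-map-+ g h (x ∷ xs) =
  trans (cong (g x + h x +_) (sum-map-+ g h xs)) (+-interchange (g x) (h x) _ _)

sum-map-swap : ∀ (h : A → B → ℕ) xs ys →
  sum (map (λ a → sum (map (h a) ys)) xs) ≡ sum (map (λ b → sum (map (λ a → h a b) xs)) ys)
sum-map-swap h []       ys = sym (sum-map-zero ys)
sum-map-swap h (x ∷ xs) ys =
  trans (cong (sum (map (h x) ys) +_) (sum-map-swap h xs ys))
        (sym (sum-map-+ (h x) (λ b → sum (map (λ a → h a b) xs)) ys))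

freeColumns : Vec Bool k → ℕ
freeColumns []ᵛ       = 0
freeColumns (b ∷ᵛ m) = (if b then 0 else 1) + freeColumns m

module RowSum (X : ℕ) where

  rowWeight : Particle → Bool → Vec Bool k → Vec Cell (suc k) → ℕ
  rowWeight {k} s e m v =
    if rowOK e v ∧ (holdsOnBlocked m (isEmpty ∘ cellAt (toList v)) ∧ eqP (particleOf (cellAt (toList v) k)) s)
    then X ^ freeColumns (markαγ v m) else 0

  rowSum : Particle → Bool → Vec Bool k → ℕ
  rowSum {k} s e m = sum (map (rowWeight s e m) (allVecs (suc k)))

  cellFactor : Cell → Bool → ℕ
  cellFactor x b = X ^ (if isαγ x ∨ b then 0 else 1)

  cellGuard : Bool → Bool → Cell → Bool
  cellGuard e b x = (isβδ x ⇒ᵇ e) ∧ (b ⇒ᵇ isEmpty x)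

  if-∧-^ : ∀ a t c u p d n →
    (if (a ∧ t) ∧ ((c ∧ u) ∧ p) then X ^ (d + n) else 0) ≡
    (if a ∧ c then X ^ d * (if t ∧ (u ∧ p) then X ^ n else 0) else 0)
  if-∧-^ false t     c     u     p     d n = refl
  if-∧-^ true  false false u     p     d n = refl
  if-∧-^ true  true  false u     p     d n = refl
  if-∧-^ true  false true  u     p     d n = sym (*-zeroʳ (X ^ d))
  if-∧-^ true  true  true  false p     d n = sym (*-zeroʳ (X ^ d))
  if-∧-^ true  true  true  true  false d n = sym (*-zeroʳ (X ^ d))
  if-∧-^ true  true  true  true  true  d n = ^-distribˡ-+-* X d n

  rowWeight-∷ : ∀ s e b (m : Vec Bool k) x v → rowWeight s e (b ∷ᵛ m) (x ∷ᵛ v) ≡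
    (if cellGuard e b x then cellFactor x b * rowWeight s (e ∧ isEmpty x) m v else 0)
  rowWeight-∷ s e b m x (y ∷ᵛ v) =
    if-∧-^ (isβδ x ⇒ᵇ e) _ (b ⇒ᵇ isEmpty x) _ _ (if isαγ x ∨ b then 0 else 1) _

  rowSum-∷ : ∀ s e b (m : Vec Bool k) → rowSum s e (b ∷ᵛ m) ≡
    sum (map (λ x → if cellGuard e b x then cellFactor x b * rowSum s (e ∧ isEmpty x) m else 0) allCells)
  rowSum-∷ {k} s e b m = begin
    sum (map (rowWeight s e (b ∷ᵛ m)) (concatMap (λ x → map (x ∷ᵛ_) vs) allCells))
      ≡⟨ sum-map-concatMap (λ x → map (x ∷ᵛ_) vs) _ allCells ⟩
    sum (map (λ x → sum (map (rowWeight s e (b ∷ᵛ m)) (map (x ∷ᵛ_) vs))) allCells)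
      ≡⟨ cong sum (map-cong cellSum allCells) ⟩
    sum (map (λ x → if cellGuard e b x then cellFactor x b * rowSum s (e ∧ isEmpty x) m else 0) allCells) ∎
    where
    open ≡-Reasoning
    vs = allVecs (suc k)
    cellSum : ∀ x → sum (map (rowWeight s e (b ∷ᵛ m)) (map (x ∷ᵛ_) vs)) ≡
      (if cellGuard e b x then cellFactor x b * rowSum s (e ∧ isEmpty x) m else 0)
    cellSum x = begin
      sum (map (rowWeight s e (b ∷ᵛ m)) (map (x ∷ᵛ_) vs))   ≡⟨ cong sum (map-∘ vs) ⟨
      sum (map (λ v → rowWeight s e (b ∷ᵛ m) (x ∷ᵛ v)) vs)  ≡⟨ cong sum (map-cong (rowWeight-∷ s e b m x) vs) ⟩
      sum (map (λ v → if cellGuard e b x then cellFactor x b * rowWeight s (e ∧ isEmpty x) m v else 0) vs)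
        ≡⟨ sum-map-if (cellGuard e b x) _ vs ⟩
      (if cellGuard e b x then sum (map (λ v → cellFactor x b * rowWeight s (e ∧ isEmpty x) m v) vs) else 0)
        ≡⟨ cong (λ n → if cellGuard e b x then n else 0) (sum-map-*ˡ (cellFactor x b) _ vs) ⟩
      (if cellGuard e b x then cellFactor x b * rowSum s (e ∧ isEmpty x) m else 0) ∎

  rowSum-value : ∀ s e (m : Vec Bool k) → rowSum s e m ≡ (if e then suc X else 1) * (2 + X) ^ freeColumns m
  rowSum-value ● true  []ᵛ = cong suc (+-identityʳ (X * 1))
  rowSum-value ○ true  []ᵛ = +-comm (X * 1) 1
  rowSum-value ● false []ᵛ = refl
  rowSum-value ○ false []ᵛ = refl
  rowSum-value s true  (true ∷ᵛ m) rewrite rowSum-∷ s true  true m | rowSum-value s true  m =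
    trans (+-identityʳ _) (*-identityˡ _)
  rowSum-value s false (true ∷ᵛ m) rewrite rowSum-∷ s false true m | rowSum-value s false m =
    trans (+-identityʳ _) (*-identityˡ _)
  rowSum-value s true (false ∷ᵛ m)
    rewrite rowSum-∷ s true false m | rowSum-value s true m | rowSum-value s false m =
    arithmetic X ((2 + X) ^ freeColumns m)
    where
    -- one summand for each content of the first box: empty, α, β, γ, δ
    arithmetic : ∀ x p → x * 1 * (suc x * p) + (1 * (1 * p) + (x * 1 * (1 * p) + (1 * (1 * p) + (x * 1 * (1 * p) + 0))))
                         ≡ suc x * ((2 + x) * p)
    arithmetic = solve-∀
  rowSum-value s false (false ∷ᵛ m)
    rewrite rowSum-∷ s false false m | rowSum-value s false m =
    arithmetic X ((2 + X) ^ freeColumns m)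
    where
    arithmetic : ∀ x p → x * 1 * (1 * p) + (1 * (1 * p) + (1 * (1 * p) + 0)) ≡ 1 * ((2 + x) * p)
    arithmetic = solve-∀

open RowSum using (rowWeight; rowSum; rowSum-value)

Zfree : ℕ → (k : ℕ) → Vec Particle k → ℕ
Zfree X k σ = sum (map (λ f → if hasType k σ f then X ^ freeColumns (blockedColumns k f) else 0) (allFillings k))

if-∧ : ∀ a b (y : ℕ) → (if a ∧ b then y else 0) ≡ (if a then (if b then y else 0) else 0)
if-∧ true  b y = refl
if-∧ false b y = refl

if-*ˡ : ∀ b c y → (if b then c * y else 0) ≡ c * (if b then y else 0)
if-*ˡ true  c y = refl
if-*ˡ false c y = sym (*-zeroʳ c)

Zfree-∷ : ∀ X k s (σ : Vec Particle k) → Zfree X (suc k) (s ∷ᵛ σ) ≡ suc X * Zfree (2 + X) k σ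
Zfree-∷ X k s σ = begin
  sum (map term (concatMap (λ v → map (v ,_) fs) vs))
    ≡⟨ sum-map-concatMap (λ v → map (v ,_) fs) term vs ⟩
  sum (map (λ v → sum (map term (map (v ,_) fs))) vs)
    ≡⟨ cong sum (map-cong (λ v → trans (cong sum (sym (map-∘ fs))) (cong sum (map-cong (term-split v) fs))) vs) ⟩
  sum (map (λ v → sum (map (λ f → if hasType k σ f then rowWeight X s true (blockedColumns k f) v else 0) fs)) vs)
    ≡⟨ sum-map-swap (λ v f → if hasType k σ f then rowWeight X s true (blockedColumns k f) v else 0) vs fs ⟩
  sum (map (λ f → sum (map (λ v → if hasType k σ f then rowWeight X s true (blockedColumns k f) v else 0) vs)) fs)
    ≡⟨ cong sum (map-cong (λ f → sum-map-if (hasType k σ f) _ vs) fs) ⟩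
  sum (map (λ f → if hasType k σ f then rowSum X s true (blockedColumns k f) else 0) fs)
    ≡⟨ cong sum (map-cong (λ f → cong (λ n → if hasType k σ f then n else 0) (rowSum-value X s true (blockedColumns k f))) fs) ⟩
  sum (map (λ f → if hasType k σ f then suc X * (2 + X) ^ freeColumns (blockedColumns k f) else 0) fs)
    ≡⟨ cong sum (map-cong (λ f → if-*ˡ (hasType k σ f) (suc X) _) fs) ⟩
  sum (map (λ f → suc X * (if hasType k σ f then (2 + X) ^ freeColumns (blockedColumns k f) else 0)) fs)
    ≡⟨ sum-map-*ˡ (suc X) _ fs ⟩
  suc X * Zfree (2 + X) k σ ∎
  where
  open ≡-Reasoning
  vs = allVecs (suc k)
  fs = allFillings k
  term : Filling (suc k) → ℕ
  term f = if hasType (suc k) (s ∷ᵛ σ) f then X ^ freeColumns (blockedColumns (suc k) f) else 0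
  term-split : ∀ v f → term (v , f) ≡ (if hasType k σ f then rowWeight X s true (blockedColumns k f) v else 0)
  term-split v f = trans (cong (λ b → if b then X ^ freeColumns (blockedColumns (suc k) (v , f)) else 0) (hasType-∷ k s σ v f))
                         (if-∧ (hasType k σ f) _ _)

Zfree-closed : ∀ k (σ : Vec Particle k) j → Zfree (suc (2 * j)) k σ * j ! ≡ 2 ^ k * (j + k) !
Zfree-closed zero    []ᵛ       j rewrite +-identityʳ j = refl
Zfree-closed (suc k) (s ∷ᵛ σ) j = begin
  Zfree (suc (2 * j)) (suc k) (s ∷ᵛ σ) * j !
    ≡⟨ cong (_* j !) (Zfree-∷ (suc (2 * j)) k s σ) ⟩
  suc (suc (2 * j)) * Zfree (2 + suc (2 * j)) k σ * j !
    ≡⟨ cong (λ X → suc (suc (2 * j)) * Zfree X k σ * j !) (odd-step j) ⟩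
  suc (suc (2 * j)) * Zfree (suc (2 * suc j)) k σ * j !
    ≡⟨ regroup j (Zfree (suc (2 * suc j)) k σ) (j !) ⟩
  2 * (Zfree (suc (2 * suc j)) k σ * suc j !)
    ≡⟨ cong (2 *_) (Zfree-closed k σ (suc j)) ⟩
  2 * (2 ^ k * (suc j + k) !)
    ≡⟨ *-assoc 2 (2 ^ k) _ ⟨
  2 ^ suc k * (suc j + k) !
    ≡⟨ cong (λ i → 2 ^ suc k * i !) (+-suc j k) ⟨
  2 ^ suc k * (j + suc k) ! ∎
  where
  open ≡-Reasoning
  odd-step : ∀ j → 2 + suc (2 * j) ≡ suc (2 * suc j)
  odd-step = solve-∀
  regroup : ∀ j z f → suc (suc (2 * j)) * z * f ≡ 2 * (z * (suc j * f))
  regroup = solve-∀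

product-map-≡1 : ∀ (g : A → ℕ) → (∀ x → g x ≡ 1) → ∀ xs → product (map g xs) ≡ 1
product-map-≡1 g g≡1 []       = refl
product-map-≡1 g g≡1 (x ∷ xs) rewrite g≡1 x | product-map-≡1 g g≡1 xs = refl

mutual
  weight-unit : ∀ n f → weight n 1 1 1 1 1 f ≡ 1
  weight-unit n f =
    product-map-≡1 _ (λ r → product-map-≡1 _ (weight-box-unit n f r) (upTo (n ∸ r))) (upTo n)

  -- The left-hand side is the box weight local to `weight`, which cannot be named here;
  -- it is determined by the use in weight-unit.
  weight-box-unit : ∀ n f r c → _ ≡ 1
  weight-box-unit n f r c with lab (rowsOf n f) r c
  ... | just α  = refl
  ... | just β  = refl
  ... | just γ  = refl
  ... | just δ  = refl
  ... | nothing with firstLabel (map (lab (rowsOf n f) r) (applyUpTo (suc c +_) (n ∸ r ∸ suc c)))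
                   | firstLabel (map (λ r′ → lab (rowsOf n f) r′ c) (range (suc r) n))
  ...   | nothing | _       = refl
  ...   | just β  | _       = refl
  ...   | just δ  | _       = refl
  ...   | just α  | nothing = refl
  ...   | just α  | just α  = refl
  ...   | just α  | just β  = refl
  ...   | just α  | just γ  = refl
  ...   | just α  | just δ  = refl
  ...   | just γ  | nothing = refl
  ...   | just γ  | just α  = refl
  ...   | just γ  | just β  = refl
  ...   | just γ  | just γ  = refl
  ...   | just γ  | just δ  = refl

Z≡Zfree : ∀ n (σ : Vec Particle n) → Z n σ 1 1 1 1 1 ≡ Zfree 1 n σ
Z≡Zfree n σ = cong sum (map-cong (λ f → cong (λ w → if hasType n σ f then w else 0)
  (trans (weight-unit n f) (sym (^-zeroˡ (freeColumns (blockedColumns n f)))))) (allFillings n))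

proposition4p4 : (n : ℕ) → 1 ≤ n → (σ : Vec Particle n) →
    Z n σ 1 1 1 1 1 ≡ 2 ^ n * n !
proposition4p4 n _ σ = begin
  Z n σ 1 1 1 1 1   ≡⟨ Z≡Zfree n σ ⟩
  Zfree 1 n σ       ≡⟨ *-identityʳ (Zfree 1 n σ) ⟨
  Zfree 1 n σ * 0 ! ≡⟨ Zfree-closed n σ 0 ⟩
  2 ^ n * n !       ∎
  where open ≡-Reasoning
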